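{- Let $\mathcal{B}=\mathcal{B}(\mathcal{C})$ be a building set on a finite set $X$ with generating collection $\mathcal{C}$, and let $S$ be an inclusion-minimal element of $\mathcal{C}$. Then $$\chi(\mathcal{B},m)=\chi(\mathcal{B}\setminus S,m)-\chi(\mathcal{B}/S,m).$$
   Context: A building set on a finite set $X$ is a collection $\mathcal{B}$ of nonempty subsets of $X$ such that (B1) if $S,S'\in\mathcal{B}$ and $S\cap S'\neq\emptyset$ then $S\cup S'\in\mathcal{B}$, and (B2) $\{i\}\in\mathcal{B}$ for all $i\in X$. For a collection $\mathcal{C}$ of subsets of $X$, $\mathcal{B}(\mathcal{C})$ denotes the smallest building set on $X$ containing $\mathcal{C}$. The generating collection of $\mathcal{B}$ is the unique minimal collection $\mathcal{C}$ (of sets with at least two elements) with $\mathcal{B}=\mathcal{B}(\mathcal{C})$. A proper coloring of $\mathcal{B}$ is $f:X\to\mathbb{N}$ such that every $T\in\mathcal{B}$ with $|T|\ge2$ contains $i,j$ with $f(i)\ne f(j)$; the chromatic polynomial $\chi(\mathcal{B},m)$ is the polynomial in $m$ whose value at a positive integer $m$ is the number of proper colorings $f:X\to[m]$ (equivalently $\chi(\mathcal{B},m)=\sum_{\alpha\models |X|}\zeta_\alpha(\mathcal{B})\binom{m}{k(\alpha)}$, where $\zeta_\alpha(\mathcal{B})$ counts ordered decompositions $X=J_1\sqcup\dots\sqcup J_k$ into blocks of sizes $a_i$ with every $\mathcal{B}|_{J_i}=\{T\in\mathcal{B}:T\subset J_i\}$ consisting only of singletons, and $k(\alpha)$ is the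 number of parts). The deletion is $\mathcal{B}\setminus S=\mathcal{B}(\mathcal{C}\setminus\{S\})$, a building set on $X$. Let $X/S=(X\setminus S)\cup\{S\}$ (the set $S$ becomes one new point) and for $A\subset X$ put $A/S=A$ if $A\cap S=\emptyset$ and $A/S=(A\setminus S)\cup\{S\}$ otherwise. The contraction is $\mathcal{B}/S=\mathcal{B}(\{A/S: A\in\mathcal{C}\})$, a building set on $X/S$. -}

module Defs where

open import Data.Nat using (ℕ; _≤_)
open import Data.Bool using (Bool)
import Data.Bool.Properties as BoolP
open import Data.Fin using (Fin; _≟_)
open import Data.Fin.Properties using (any?)
open import Data.Fin.Subset using (Subset; _∈_; _∉_; _⊆_; _∪_; _∩_; ⁅_⁆; ∣_∣; Nonempty)
open import Data.Fin.Subset.Properties using (_∈?_)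
open import Data.Vec using (Vec; lookup; tabulate)
open import Data.Vec.Properties using (≡-dec)
open import Data.List using (List; length; map; filter)
import Data.List.Membership.Propositional as LM
open import Data.List.Relation.Unary.Unique.Propositional using (Unique)
open import Data.Product using (Σ; ∃; ∃-syntax; _×_; _,_)
open import Relation.Binary.PropositionalEquality using (_≡_; _≢_)
open import Relation.Nullary using (¬?; ⌊_⌋)
open import Relation.Nullary.Decidable using (_×-dec_)
open import Function.Bundles using (_⇔_)

_∈ₗ_ : ∀ {n} → Subset n → List (Subset n) → Set
S ∈ₗ C = S LM.∈ C

-- A collection of subsets of X = Fin n, represented by a list (order and
-- repetitions are irrelevant; only membership matters).
Collection : ℕ → Set
Collection n = List (Subset n)

-- B(C): the smallest building set on Fin n containing C, as an inductive
-- closure: contains C, all singletons (B2), and closed under unions of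
-- intersecting members (B1).
data Bld {n : ℕ} (C : Collection n) : Subset n → Set where
  gen    : ∀ {S} → S ∈ₗ C → Bld C S
  single : ∀ i → Bld C ⁅ i ⁆
  union  : ∀ {S T} → Bld C S → Bld C T → Nonempty (S ∩ T) → Bld C (S ∪ T)

IsGeneratingCollection : ∀ {n} → Collection n → Set
IsGeneratingCollection {n} C =
  (∀ S → S ∈ₗ C → 2 ≤ ∣ S ∣) ×
  (∀ (C' : Collection n) → (∀ T → T ∈ₗ C' → T ∈ₗ C) →
     (∀ T → Bld C' T ⇔ Bld C T) → ∀ T → T ∈ₗ C → T ∈ₗ C')

_≟ₛ_ : ∀ {n} (S T : Subset n) → Relation.Nullary.Dec (S ≡ T)
_≟ₛ_ = ≡-dec BoolP._≟_

-- Deletion: B \ S = B(C \ {S}) (given by the collection C \ {S}).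
deletion : ∀ {n} → Subset n → Collection n → Collection n
deletion S C = filter (λ T → ¬? (T ≟ₛ S)) C

-- A map π : X → Fin k realising X/S = (X \ S) ∪ {S}: it collapses S to one
-- point, is injective on X \ S, separates X \ S from the point S, and is onto.
IsContractionMap : ∀ {n k} → Subset n → (Fin n → Fin k) → Set
IsContractionMap {n} {k} S π =
  (∀ x y → x ∈ S → y ∈ S → π x ≡ π y) ×
  (∀ x y → x ∉ S → y ∉ S → π x ≡ π y → x ≡ y) ×
  (∀ x y → x ∈ S → y ∉ S → π x ≢ π y) ×
  (∀ q → ∃[ x ] π x ≡ q)

-- image of a subset under π; for π a contraction map this is A/S.
image : ∀ {n k} → (Fin n → Fin k) → Subset n → Subset k
image {n} π A = tabulate (λ q → ⌊ any? (λ x → (x ∈? A) ×-dec (π x ≟ q)) ⌋)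

-- Contraction: B/S = B({A/S : A ∈ C}), a building set on X/S ≅ Fin k.
contraction : ∀ {n k} → (Fin n → Fin k) → Collection n → Collection k
contraction π C = map (image π) C

Proper : ∀ {n m} → Collection n → Vec (Fin m) n → Set
Proper {n} C f = ∀ T → Bld C T → 2 ≤ ∣ T ∣ →
  ∃[ i ] ∃[ j ] (i ∈ T × j ∈ T × lookup f i ≢ lookup f j)

ChromCount : ∀ {n} → Collection n → ℕ → ℕ → Set
ChromCount {n} C m N =
  Σ (List (Vec (Fin m) n)) λ L →
    Unique L × length L ≡ N × (∀ f → (f LM.∈ L) ⇔ Proper C f)

-- Split the proper colourings of B∖S by whether they are constant on S. Those that
-- are not are exactly the proper colourings of B, since a member of B outside B∖S
-- contains S. Those that are factor through the contraction X → X/S, and are then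
-- exactly the pullbacks of proper colourings of B/S: by minimality every other
-- generator A ⊄ S keeps two distinct points in A/S, while S becomes a point.
-- Hence χ(B∖S) = χ(B) + χ(B/S).

module Submission where

open import Defs
open import Data.Nat using (ℕ; _≤_)
open import Data.Fin using (Fin)
open import Data.Fin.Subset using (Subset; _⊆_)
open import Data.Integer using (ℤ; +_; _-_)
open import Relation.Binary.PropositionalEquality using (_≡_)

open import Data.Nat using (zero; suc; _+_; _∸_; z≤n; s≤s)
open import Data.Integer using (_⊖_)
import Data.Nat.Properties as ℕ
import Data.Integer.Properties as ℤ
open import Data.Fin using (zero; suc) renaming (_≟_ to _≟ᶠ_)
open import Data.Fin.Properties using (any?; suc-injective)
open import Data.Fin.Subset using (_∈_; _∉_; _∪_; _∩_; ⁅_⁆; ∣_∣; Nonempty; inside; outside)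
open import Data.Fin.Subset.Properties
  using (_∈?_; x∈⁅y⁆⇒x≡y; ∣⁅x⁆∣≡1; p⊆q⇒∣p∣≤∣q∣; x∈p∧x≢y⇒x∈p-y; x∈p⇒∣p-x∣<∣p∣;
         p⊆p∪q; q⊆p∪q; x∈p∪q⁻; x∈p∩q⁻)
open import Data.Vec using (Vec; _∷_; lookup; tabulate; here; there)
open import Data.Vec.Properties using (lookup∘tabulate; tabulate∘lookup; tabulate-cong; []=⇒lookup; lookup⇒[]=)
open import Data.List using (List; []; _∷_; length; map; filter)
open import Data.List.Properties using (length-map)
import Data.List.Membership.Propositional as List
open import Data.List.Membership.Propositional.Properties using (∈-filter⁻; ∈-filter⁺; ∈-map⁻; ∈-map⁺)
open import Data.List.Membership.Propositional.Properties.WithK using (unique∧set⇒bag)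
open import Data.List.Relation.Binary.BagAndSetEquality using (∼bag⇒↭)
open import Data.List.Relation.Binary.Permutation.Propositional.Properties using (↭-length)
open import Data.List.Relation.Unary.Unique.Propositional using (Unique)
import Data.List.Relation.Unary.Unique.Propositional.Properties as Unique
open import Data.Product using (∃₂; ∃-syntax; _×_; _,_; proj₁; proj₂)
open import Data.Sum using (_⊎_; inj₁; inj₂)
open import Data.Bool.Properties using (T-≡)
open import Relation.Binary.PropositionalEquality using (_≢_; refl; sym; trans; cong; cong₂; subst; subst₂; module ≡-Reasoning)
open import Relation.Nullary using (Dec; yes; no; ¬_; ¬?; contradiction)
open import Relation.Nullary.Decidable using (_×-dec_; toWitness; fromWitness)
open import Relation.Unary using (Decidable)
open import Function using (_∘_; Injective)
open import Function.Bundles using (_⇔_; mk⇔; Equivalence)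

private
  variable
    n k m : ℕ
    A : Set
    B : Set

open Equivalence

Enumerates : (A → Set) → ℕ → Set
Enumerates {A} P N = ∃[ L ] (Unique L × length L ≡ N × (∀ x → x List.∈ L ⇔ P x))

Enumerates-unique : {P Q : A → Set} {N N' : ℕ} →
  Enumerates P N → Enumerates Q N' → (∀ x → P x ⇔ Q x) → N ≡ N'
Enumerates-unique (L , uL , ∣L∣≡N , ∈L⇔P) (L' , uL' , ∣L'∣≡N' , ∈L'⇔Q) P⇔Q =
  trans (sym ∣L∣≡N) (trans (↭-length (∼bag⇒↭ (unique∧set⇒bag uL uL' L∼L'))) ∣L'∣≡N')
  where
  L∼L' : ∀ {x} → x List.∈ L ⇔ x List.∈ L'
  L∼L' {x} = mk⇔ (from (∈L'⇔Q x) ∘ to (P⇔Q x) ∘ to (∈L⇔P x))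
                  (from (∈L⇔P x) ∘ from (P⇔Q x) ∘ to (∈L'⇔Q x))

length-filter+length-filter-¬ : {P : A → Set} (P? : Decidable P) (xs : List A) →
  length xs ≡ length (filter P? xs) + length (filter (¬? ∘ P?) xs)
length-filter+length-filter-¬ P? [] = refl
length-filter+length-filter-¬ P? (x ∷ xs) with P? x
... | yes _ = cong suc (length-filter+length-filter-¬ P? xs)
... | no _ = trans (cong suc (length-filter+length-filter-¬ P? xs)) (sym (ℕ.+-suc _ _))

Enumerates-split : {P Q : A → Set} {N : ℕ} → Enumerates P N → Decidable Q →
  ∃₂ λ N₁ N₂ → Enumerates (λ x → P x × Q x) N₁ × Enumerates (λ x → P x × ¬ Q x) N₂ × N ≡ N₁ + N₂
Enumerates-split {P = P} (L , uL , ∣L∣≡N , ∈L⇔P) Q? =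
  _ , _ , part Q? , part (¬? ∘ Q?) , trans (sym ∣L∣≡N) (length-filter+length-filter-¬ Q? L)
  where
  part : {R : _ → Set} (R? : Decidable R) → Enumerates (λ x → P x × R x) (length (filter R? L))
  part R? = filter R? L , Unique.filter⁺ R? uL , refl , λ x → mk⇔
    (λ x∈ → let (x∈L , Rx) = ∈-filter⁻ R? x∈ in to (∈L⇔P x) x∈L , Rx)
    (λ (Px , Rx) → ∈-filter⁺ R? (from (∈L⇔P x) Px) Rx)

Enumerates-map : {P : A → Set} {N : ℕ} {φ : A → B} → Injective _≡_ _≡_ φ →
  Enumerates P N → Enumerates (λ y → ∃[ x ] (P x × φ x ≡ y)) N
Enumerates-map {φ = φ} φ-injective (L , uL , ∣L∣≡N , ∈L⇔P) =
  map φ L , Unique.map⁺ φ-injective uL , trans (length-map φ L) ∣L∣≡N , λ y → mk⇔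
    (λ y∈ → let (x , x∈L , y≡φx) = ∈-map⁻ φ y∈ in x , to (∈L⇔P x) x∈L , sym y≡φx)
    (λ (x , Px , φx≡y) → subst (List._∈ map φ L) φx≡y (∈-map⁺ φ (from (∈L⇔P x) Px)))

∣p∣≥1⇒nonempty : (p : Subset n) → 1 ≤ ∣ p ∣ → Nonempty p
∣p∣≥1⇒nonempty (inside ∷ p) _ = zero , here
∣p∣≥1⇒nonempty (outside ∷ p) ∣p∣≥1 with ∣p∣≥1⇒nonempty p ∣p∣≥1
... | i , i∈p = suc i , there i∈p

∣p∣≥2⇒distinct : (p : Subset n) → 2 ≤ ∣ p ∣ → ∃₂ λ i j → i ∈ p × j ∈ p × i ≢ j
∣p∣≥2⇒distinct (inside ∷ p) (s≤s ∣p∣≥1) with ∣p∣≥1⇒nonempty p ∣p∣≥1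
... | j , j∈p = zero , suc j , here , there j∈p , λ ()
∣p∣≥2⇒distinct (outside ∷ p) ∣p∣≥2 with ∣p∣≥2⇒distinct p ∣p∣≥2
... | i , j , i∈p , j∈p , i≢j = suc i , suc j , there i∈p , there j∈p , i≢j ∘ suc-injective

∣p∣≥2⇒∃∈≢ : (p : Subset n) → 2 ≤ ∣ p ∣ → (x : Fin n) → ∃[ y ] (y ∈ p × y ≢ x)
∣p∣≥2⇒∃∈≢ p ∣p∣≥2 x with ∣p∣≥2⇒distinct p ∣p∣≥2
... | i , j , i∈p , j∈p , i≢j with i ≟ᶠ x
...   | yes refl = j , j∈p , i≢j ∘ sym
...   | no i≢x = i , i∈p , i≢x

⊈⇒∃∈∉ : {p q : Subset n} → ¬ p ⊆ q → ∃[ x ] (x ∈ p × x ∉ q)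
⊈⇒∃∈∉ {p = p} {q} p⊈q with any? (λ x → (x ∈? p) ×-dec ¬? (x ∈? q))
... | yes witness = witness
... | no none = contradiction (λ {x} → p⊆q {x}) p⊈q
  where
  p⊆q : p ⊆ q
  p⊆q {x} x∈p with x ∈? q
  ... | yes x∈q = x∈q
  ... | no x∉q = contradiction (x , x∈p , x∉q) none

x∈p⇒∣p∣≥1 : {p : Subset n} {x : Fin n} → x ∈ p → 1 ≤ ∣ p ∣
x∈p⇒∣p∣≥1 {p = p} {x} x∈p =
  subst (_≤ ∣ p ∣) (∣⁅x⁆∣≡1 x)
    (p⊆q⇒∣p∣≤∣q∣ λ y∈⁅x⁆ → subst (_∈ p) (sym (x∈⁅y⁆⇒x≡y x y∈⁅x⁆)) x∈p)

distinct⇒∣p∣≥2 : {p : Subset n} {x y : Fin n} → x ∈ p → y ∈ p → x ≢ y → 2 ≤ ∣ p ∣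
distinct⇒∣p∣≥2 x∈p y∈p x≢y =
  ℕ.≤-trans (s≤s (x∈p⇒∣p∣≥1 (x∈p∧x≢y⇒x∈p-y y∈p (x≢y ∘ sym)))) (x∈p⇒∣p-x∣<∣p∣ x∈p)

Subsingleton : Subset n → Set
Subsingleton T = ∃[ q ] (∀ {x} → x ∈ T → x ≡ q)

∣p∣≥2⇒¬subsingleton : (p : Subset n) → 2 ≤ ∣ p ∣ → ¬ Subsingleton p
∣p∣≥2⇒¬subsingleton p ∣p∣≥2 (q , ≡q) with ∣p∣≥2⇒distinct p ∣p∣≥2
... | i , j , i∈p , j∈p , i≢j = i≢j (trans (≡q i∈p) (sym (≡q j∈p)))

subsingleton-∪ : (S T : Subset n) → Nonempty (S ∩ T) →
  Subsingleton S → Subsingleton T → Subsingleton (S ∪ T)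
subsingleton-∪ S T (z , z∈S∩T) (q , ≡q) (q' , ≡q') = q , λ x∈S∪T → [ x∈S∪T ]
  where
  q'≡q : q' ≡ q
  q'≡q = let (z∈S , z∈T) = x∈p∩q⁻ S T z∈S∩T in trans (sym (≡q' z∈T)) (≡q z∈S)
  [_] : ∀ {x} → x ∈ S ∪ T → x ≡ q
  [_] {x} x∈S∪T with x∈p∪q⁻ S T x∈S∪T
  ... | inj₁ x∈S = ≡q x∈S
  ... | inj₂ x∈T = trans (≡q' x∈T) q'≡q

Varies : (Fin n → B) → Subset n → Set
Varies h T = ∃₂ λ i j → i ∈ T × j ∈ T × h i ≢ h j

varies? : (h : Fin n → Fin m) → (T : Subset n) → Dec (Varies h T)
varies? h T = any? λ i → any? λ j → (i ∈? T) ×-dec ((j ∈? T) ×-dec ¬? (h i ≟ᶠ h j))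

Varies-⊆ : {h : Fin n → B} {T T' : Subset n} → T ⊆ T' → Varies h T → Varies h T'
Varies-⊆ T⊆T' (i , j , i∈T , j∈T , hi≢hj) = i , j , T⊆T' i∈T , T⊆T' j∈T , hi≢hj

Varies-cong : {h h' : Fin n → B} {T : Subset n} → (∀ x → h x ≡ h' x) → Varies h T → Varies h' T
Varies-cong h≗h' (i , j , i∈T , j∈T , hi≢hj) =
  i , j , i∈T , j∈T , λ e → hi≢hj (trans (h≗h' i) (trans e (sym (h≗h' j))))

∈-image⁻ : (π : Fin n → Fin k) {T : Subset n} {q : Fin k} → q ∈ image π T → ∃[ x ] (x ∈ T × π x ≡ q)
∈-image⁻ π {T} {q} q∈πT = toWitness (from T-≡ (trans (sym (lookup∘tabulate _ q)) ([]=⇒lookup q∈πT)))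

∈-image⁺ : (π : Fin n → Fin k) {T : Subset n} {x : Fin n} → x ∈ T → π x ∈ image π T
∈-image⁺ π {T} {x} x∈T =
  lookup⇒[]= (π x) (image π T) (trans (lookup∘tabulate _ (π x)) (to T-≡ (fromWitness (x , x∈T , refl))))

Varies-image : (π : Fin n → Fin k) {h : Fin k → B} {T : Subset n} →
  Varies (h ∘ π) T ⇔ Varies h (image π T)
Varies-image π {h} = mk⇔
  (λ (i , j , i∈T , j∈T , hπi≢hπj) → π i , π j , ∈-image⁺ π i∈T , ∈-image⁺ π j∈T , hπi≢hπj)
  (λ (q , q' , q∈ , q'∈ , hq≢hq') →
    let (i , i∈T , πi≡q) = ∈-image⁻ π q∈
        (j , j∈T , πj≡q') = ∈-image⁻ π q'∈
    in i , j , i∈T , j∈T , λ e → hq≢hq' (subst₂ (λ a b → h a ≡ h b) πi≡q πj≡q' e))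

Bld-mono : {C D : Collection n} → (∀ {T} → T ∈ₗ D → T ∈ₗ C) → ∀ {T} → Bld D T → Bld C T
Bld-mono D⊆C (gen T∈D) = gen (D⊆C T∈D)
Bld-mono D⊆C (single i) = single i
Bld-mono D⊆C (union b b' ne) = union (Bld-mono D⊆C b) (Bld-mono D⊆C b') ne

Bld-varies⊎subsingleton : {h : Fin n → B} {D : Collection n} →
  (∀ {A} → A ∈ₗ D → Varies h A ⊎ Subsingleton A) →
  ∀ {T} → Bld D T → Varies h T ⊎ Subsingleton T
Bld-varies⊎subsingleton onGen (gen A∈D) = onGen A∈D
Bld-varies⊎subsingleton onGen (single i) = inj₂ (i , x∈⁅y⁆⇒x≡y i)
Bld-varies⊎subsingleton onGen (union {S} {T} bS bT ne)
  with Bld-varies⊎subsingleton onGen bS | Bld-varies⊎subsingleton onGen bT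
... | inj₁ vS | _       = inj₁ (Varies-⊆ (p⊆p∪q T) vS)
... | inj₂ _  | inj₁ vT = inj₁ (Varies-⊆ (q⊆p∪q S T) vT)
... | inj₂ sS | inj₂ sT = inj₂ (subsingleton-∪ S T ne sS sT)

proper-if-generators : {D : Collection n} {f : Vec (Fin m) n} →
  (∀ {A} → A ∈ₗ D → Varies (lookup f) A ⊎ Subsingleton A) → Proper D f
proper-if-generators onGen T bT ∣T∣≥2 with Bld-varies⊎subsingleton onGen bT
... | inj₁ vT = vT
... | inj₂ sT = contradiction sT (∣p∣≥2⇒¬subsingleton T ∣T∣≥2)

module _ {S : Subset n} {C : Collection n} where

  ∈-deletion⁺ : ∀ {A} → A ∈ₗ C → A ≢ S → A ∈ₗ deletion S C
  ∈-deletion⁺ = ∈-filter⁺ (λ T → ¬? (T ≟ₛ S))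

  ∈-deletion⁻ : ∀ {A} → A ∈ₗ deletion S C → A ∈ₗ C × A ≢ S
  ∈-deletion⁻ = ∈-filter⁻ (λ T → ¬? (T ≟ₛ S))

  Bld-deletion⊎⊇ : ∀ {T} → Bld C T → Bld (deletion S C) T ⊎ S ⊆ T
  Bld-deletion⊎⊇ (gen {T} T∈C) with T ≟ₛ S
  ... | yes refl = inj₂ (λ x∈S → x∈S)
  ... | no T≢S = inj₁ (gen (∈-deletion⁺ T∈C T≢S))
  Bld-deletion⊎⊇ (single i) = inj₁ (single i)
  Bld-deletion⊎⊇ (union {T₁} {T₂} b₁ b₂ ne) with Bld-deletion⊎⊇ b₁ | Bld-deletion⊎⊇ b₂
  ... | inj₂ S⊆T₁ | _         = inj₂ (p⊆p∪q T₂ ∘ S⊆T₁)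
  ... | inj₁ _    | inj₂ S⊆T₂ = inj₂ (q⊆p∪q T₁ T₂ ∘ S⊆T₂)
  ... | inj₁ d₁   | inj₁ d₂   = inj₁ (union d₁ d₂ ne)

  proper⇔proper-deletion×varies : S ∈ₗ C → 2 ≤ ∣ S ∣ → (f : Vec (Fin m) n) →
    Proper C f ⇔ (Proper (deletion S C) f × Varies (lookup f) S)
  proper⇔proper-deletion×varies S∈C ∣S∣≥2 f = mk⇔
    (λ pC → (λ T bT → pC T (Bld-mono (proj₁ ∘ ∈-deletion⁻) bT)) , pC S (gen S∈C) ∣S∣≥2)
    fromDeletion
    where
    fromDeletion : Proper (deletion S C) f × Varies (lookup f) S → Proper C f
    fromDeletion (pD , vS) T bT ∣T∣≥2 with Bld-deletion⊎⊇ bT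
    ... | inj₁ bDT = pD T bDT ∣T∣≥2
    ... | inj₂ S⊆T = Varies-⊆ S⊆T vS

module Contraction {S : Subset n} {π : Fin n → Fin k} (isContraction : IsContractionMap S π) where

  private
    collapses : ∀ x y → x ∈ S → y ∈ S → π x ≡ π y
    collapses = proj₁ isContraction
    injective-outside : ∀ x y → x ∉ S → y ∉ S → π x ≡ π y → x ≡ y
    injective-outside = proj₁ (proj₂ isContraction)
    separates : ∀ x y → x ∈ S → y ∉ S → π x ≢ π y
    separates = proj₁ (proj₂ (proj₂ isContraction))
    surjective : ∀ q → ∃[ x ] π x ≡ q
    surjective = proj₂ (proj₂ (proj₂ isContraction))

  pullback : Vec (Fin m) k → Vec (Fin m) n
  pullback g = tabulate (lookup g ∘ π)

  lookup-pullback : (g : Vec (Fin m) k) → ∀ x → lookup (pullback g) x ≡ lookup g (π x)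
  lookup-pullback g = lookup∘tabulate (lookup g ∘ π)

  pullback-injective : Injective _≡_ _≡_ (pullback {m})
  pullback-injective {x = g} {y = g'} pg≡pg' =
    trans (sym (tabulate∘lookup g)) (trans (tabulate-cong agree) (tabulate∘lookup g'))
    where
    agree : ∀ q → lookup g q ≡ lookup g' q
    agree q with surjective q
    ... | x , refl = begin
      lookup g (π x)          ≡⟨ lookup-pullback g x ⟨
      lookup (pullback g) x   ≡⟨ cong (λ f → lookup f x) pg≡pg' ⟩
      lookup (pullback g') x  ≡⟨ lookup-pullback g' x ⟩
      lookup g' (π x)         ∎
      where open ≡-Reasoning

  pullback-constant-on-S : (g : Vec (Fin m) k) → ¬ Varies (lookup (pullback g)) S
  pullback-constant-on-S g vS = contradiction
    (Varies-cong (lookup-pullback g) vS)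
    λ (i , j , i∈S , j∈S , gπi≢gπj) → gπi≢gπj (cong (lookup g) (collapses i j i∈S j∈S))

  constant-on-S⇒pullback : (f : Vec (Fin m) n) → ¬ Varies (lookup f) S → ∃[ g ] pullback g ≡ f
  constant-on-S⇒pullback f constant =
    g , trans (tabulate-cong factors) (tabulate∘lookup f)
    where
    g = tabulate (lookup f ∘ proj₁ ∘ surjective)
    agree : ∀ {x y} → π y ≡ π x → lookup f y ≡ lookup f x
    agree {x} {y} πy≡πx with x ∈? S | y ∈? S
    ... | yes x∈S | yes y∈S with lookup f y ≟ᶠ lookup f x
    ...   | yes e = e
    ...   | no fy≢fx = contradiction (y , x , y∈S , x∈S , fy≢fx) constant
    agree πy≡πx | yes x∈S | no y∉S = contradiction (sym πy≡πx) (separates _ _ x∈S y∉S)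
    agree πy≡πx | no x∉S | yes y∈S = contradiction πy≡πx (separates _ _ y∈S x∉S)
    agree πy≡πx | no x∉S | no y∉S = cong (lookup f) (injective-outside _ _ y∉S x∉S πy≡πx)
    factors : ∀ x → lookup g (π x) ≡ lookup f x
    factors x = trans (lookup∘tabulate _ (π x)) (agree (proj₂ (surjective (π x))))

  image-subsingleton : Nonempty S → Subsingleton (image π S)
  image-subsingleton (s , s∈S) = π s , λ q∈πS →
    let (x , x∈S , πx≡q) = ∈-image⁻ π q∈πS in trans (sym πx≡q) (collapses x s x∈S s∈S)

  ∣image∣≥2 : {A : Subset n} → 2 ≤ ∣ A ∣ → ¬ A ⊆ S → 2 ≤ ∣ image π A ∣
  ∣image∣≥2 {A} ∣A∣≥2 A⊈S with ⊈⇒∃∈∉ A⊈S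
  ... | x , x∈A , x∉S with ∣p∣≥2⇒∃∈≢ A ∣A∣≥2 x
  ... | y , y∈A , y≢x = distinct⇒∣p∣≥2 (∈-image⁺ π x∈A) (∈-image⁺ π y∈A) πx≢πy
    where
    πx≢πy : π x ≢ π y
    πx≢πy πx≡πy with y ∈? S
    ... | yes y∈S = separates y x y∈S x∉S (sym πx≡πy)
    ... | no y∉S = y≢x (sym (injective-outside x y x∉S y∉S πx≡πy))

  module _ {C : Collection n} (atLeastTwo : ∀ A → A ∈ₗ C → 2 ≤ ∣ A ∣)
           (minimal : ∀ A → A ∈ₗ C → A ⊆ S → A ≡ S) where

    proper-contraction⇔proper-deletion : (g : Vec (Fin m) k) →
      Proper (contraction π C) g ⇔ Proper (deletion S C) (pullback g)
    proper-contraction⇔proper-deletion g = mk⇔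
      (λ pK → proper-if-generators {f = pullback g} λ A∈D →
        let (A∈C , A≢S) = ∈-deletion⁻ A∈D
            ∣πA∣≥2 = ∣image∣≥2 (atLeastTwo _ A∈C) (A≢S ∘ minimal _ A∈C)
            vπA = pK _ (gen (∈-map⁺ (image π) A∈C)) ∣πA∣≥2
        in inj₁ (Varies-cong (sym ∘ lookup-pullback g) (from (Varies-image π) vπA)))
      λ pD → proper-if-generators {f = g} λ T∈K → onImage pD (∈-map⁻ (image π) T∈K)
      where
      onImage : Proper (deletion S C) (pullback g) → ∀ {T} →
        ∃[ A ] (A ∈ₗ C × T ≡ image π A) → Varies (lookup g) T ⊎ Subsingleton T
      onImage pD (A , A∈C , refl) with A ≟ₛ S
      ... | yes refl =
        inj₂ (image-subsingleton (∣p∣≥1⇒nonempty S (ℕ.≤-trans (s≤s z≤n) (atLeastTwo S A∈C))))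
      ... | no A≢S = inj₁ (to (Varies-image π)
              (Varies-cong (lookup-pullback g) (pD A (gen (∈-deletion⁺ A∈C A≢S)) (atLeastTwo A A∈C))))

    pullback-of-proper⇔proper-deletion×constant : (f : Vec (Fin m) n) →
      (∃[ g ] (Proper (contraction π C) g × pullback g ≡ f)) ⇔
      (Proper (deletion S C) f × ¬ Varies (lookup f) S)
    pullback-of-proper⇔proper-deletion×constant f = mk⇔
      (λ (g , pK , pg≡f) → subst (λ f → Proper (deletion S C) f × ¬ Varies (lookup f) S) pg≡f
        (to (proper-contraction⇔proper-deletion g) pK , pullback-constant-on-S g))
      λ (pD , constant) → let (g , pg≡f) = constant-on-S⇒pullback f constant in
        g , from (proper-contraction⇔proper-deletion g) (subst (Proper _) (sym pg≡f) pD) , pg≡f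

m≡n+o⇒+n≡+m-+o : {m n o : ℕ} → m ≡ n + o → + n ≡ + m - + o
m≡n+o⇒+n≡+m-+o {n = n} {o} refl = begin
  + n                 ≡⟨ cong +_ (ℕ.m+n∸n≡m n o) ⟨
  + (n + o ∸ o)       ≡⟨ ℤ.⊖-≥ (ℕ.m≤n+m o n) ⟨
  (n + o) ⊖ o         ≡⟨ ℤ.m-n≡m⊖n (n + o) o ⟨
  + (n + o) - + o     ∎
  where open ≡-Reasoning

theorem3 : ∀ {n : ℕ} (C : Collection n) → IsGeneratingCollection C →
    (S : Subset n) → S ∈ₗ C → (∀ S' → S' ∈ₗ C → S' ⊆ S → S' ≡ S) →
    ∀ {k : ℕ} (π : Fin n → Fin k) → IsContractionMap S π →
    ∀ (m : ℕ) → 1 ≤ m → ∀ (N₁ N₂ N₃ : ℕ) →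
    ChromCount C m N₁ → ChromCount (deletion S C) m N₂ →
    ChromCount (contraction π C) m N₃ →
    + N₁ ≡ + N₂ - + N₃
theorem3 C (atLeastTwo , _) S S∈C minimal π isContraction m _ N₁ N₂ N₃ χ₁ χ₂ χ₃
  with Enumerates-split χ₂ (λ f → varies? (lookup f) S)
... | Nᵥ , N꜀ , χᵥ , χ꜀ , N₂≡Nᵥ+N꜀ = m≡n+o⇒+n≡+m-+o (trans N₂≡Nᵥ+N꜀ (sym (cong₂ _+_ N₁≡Nᵥ N₃≡N꜀)))
  where
  open Contraction isContraction
  N₁≡Nᵥ : N₁ ≡ Nᵥ
  N₁≡Nᵥ = Enumerates-unique χ₁ χᵥ (proper⇔proper-deletion×varies S∈C (atLeastTwo S S∈C))
  N₃≡N꜀ : N₃ ≡ N꜀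
  N₃≡N꜀ = Enumerates-unique (Enumerates-map pullback-injective χ₃) χ꜀
    (pullback-of-proper⇔proper-deletion×constant atLeastTwo minimal)
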